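{- For every integer $k\ge 2$, the complete graph $K_{2k}$ has a $3$-edge-coloring that is quasi-majority and neighbor sum distinguishing, in which at least $k-1$ vertices are each incident to at most $k-1$ edges of color $2$.
   Context: A $k$-edge-coloring of a graph $G$ is any map $c:E(G)\to[k]$ (adjacent edges may receive the same color). It induces $\sigma_c(v)=\sum_{u\in N(v)}c(vu)$. The coloring is neighbor sum distinguishing if $\sigma_c(u)\ne\sigma_c(v)$ for every edge $uv$, and quasi-majority if every vertex $v$ is incident to at most $\lceil d(v)/2\rceil$ edges of each color. -}

module Defs where

open import Data.Nat using (ℕ; zero; suc; _+_; _≤_; _/_)
open import Data.Fin using (Fin; toℕ; _≟_)
open import Data.Nat.ListAction using (sum)
open import Data.List using (List; map; filter; length; allFin)
open import Data.Product using (_×_)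
open import Relation.Nullary using (¬_; yes; no)
open import Relation.Nullary.Decidable using (¬?)
open import Relation.Binary.PropositionalEquality using (_≡_; _≢_)

-- An edge-colouring of the complete graph K_n with colours in [k] = {1,…,k}:
-- colour i is represented by (j : Fin k) with i = 1 + toℕ j.
-- A map on the edges {u,v} (u ≠ v) is encoded as a function on ordered
-- pairs that is symmetric on distinct pairs; diagonal values are ignored.
EdgeColouring : ℕ → ℕ → Set
EdgeColouring n k = Fin n → Fin n → Fin k

IsSymmetric : ∀ {n k} → EdgeColouring n k → Set
IsSymmetric {n} c = (u v : Fin n) → u ≢ v → c u v ≡ c v u

colourValue : ∀ {k} → Fin k → ℕ
colourValue j = suc (toℕ j)

neighbours : ∀ {n} → Fin n → List (Fin n)
neighbours {n} v = filter (λ u → ¬? (u ≟ v)) (allFin n)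

degree : ∀ {n} → Fin n → ℕ
degree v = length (neighbours v)

σ : ∀ {n k} → EdgeColouring n k → Fin n → ℕ
σ c v = sum (map (λ u → colourValue (c v u)) (neighbours v))

colourDegree : ∀ {n k} → EdgeColouring n k → Fin n → Fin k → ℕ
colourDegree c v j = length (filter (λ u → c v u ≟ j) (neighbours v))

ceilHalf : ℕ → ℕ
ceilHalf d = (d + 1) / 2

NeighbourSumDistinguishing : ∀ {n k} → EdgeColouring n k → Set
NeighbourSumDistinguishing {n} c = (u v : Fin n) → u ≢ v → σ c u ≢ σ c v

QuasiMajority : ∀ {n k} → EdgeColouring n k → Set
QuasiMajority {n} {k} c = (v : Fin n) (j : Fin k) → colourDegree c v j ≤ ceilHalf (degree v)

-- Induction on k, adding two vertices at a time.  Suppose K_{2k} carries a good colouring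
-- whose vertex sums all lie in the window [3k − 2, 5k − 2], together with a set B of k − 1
-- vertices having at most k − 1 edges of colour 2.  Add a heavy vertex x and a light vertex y,
-- with xy of colour 2, and join each old vertex v to (x, y) by colours (2, 2) if v ∈ B and
-- (3, 1) otherwise.  Every old sum grows by exactly 4, while σ(x) = 5k + 3 and σ(y) = 3k + 1 are
-- the endpoints of the next window, strictly beyond all shifted old sums.  Colour 2 occurs k times
-- at x and y and is unchanged at old vertices outside B, so the next B can be taken among
-- x, y and V ∖ B: alternately the first and the last k of the 2k + 2 vertices.

module Submission where

open import Data.Bool using (Bool; true; false; not; T; if_then_else_)
open import Data.Fin using (Fin; zero; suc; toℕ; _≟_)
import Data.Fin as Fin
open import Data.Fin.Properties using (all?; suc-injective)
open import Data.Fin.Subset using (Subset; _∈_; ∣_∣)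
open import Data.List using (List; []; _∷_; map; filter; length; allFin; tabulate)
open import Data.List.Properties using (filter-≐; filter-all; map-∘; map-tabulate; length-map; length-tabulate)
open import Data.List.Relation.Unary.All.Properties using (tabulate⁺)
open import Data.Nat using (ℕ; zero; suc; _+_; _*_; _∸_; _≤_; _<_; _<ᵇ_; z≤n; s≤s; _≤?_)
import Data.Nat as ℕ
open import Data.Nat.DivMod using (m*n/n≡m)
open import Data.Nat.ListAction using (sum)
open import Data.Nat.Properties
  using (+-0-monoid; +-suc; +-identityʳ; +-cancelˡ-≡; m+n∸m≡n; m≤n⇒m≤1+n; ≤-refl; ≤-trans; ≤-reflexive;
         <⇒≤; <⇒≢; >⇒≢; +-monoʳ-≤; <ᵇ⇒<; <-asym; <-trans; n<1+n; module ≤-Reasoning)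
open import Data.Nat.Tactic.RingSolver using (solve-∀)
open import Data.Product using (Σ; _×_; _,_)
import Data.Vec as Vec
open Vec using (Vec; _∷_; [])
open import Data.Vec.Properties using (lookup∘tabulate; []=⇒lookup)
open import Function using (_∘_)
open import Level using (0ℓ)
open import Relation.Binary.PropositionalEquality
  using (_≡_; refl; sym; trans; cong; cong₂; subst; module ≡-Reasoning)
open import Relation.Nullary using (¬_; does; ¬?; contradiction)
open import Relation.Nullary.Decidable using (from-yes; _→-dec_; T?)
open import Relation.Unary using (Pred; Decidable)

open import Defs
open import Algebra.Properties.Monoid.Sum +-0-monoid using (sum-syntax; sum-replicate-zero)

indicator : Bool → ℕ
indicator true  = 1
indicator false = 0

count : ∀ {n} → (Fin n → Bool) → ℕ
count {n} p = ∑[ i < n ] indicator (p i)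

∑-select : ∀ {n} (p : Fin n → Bool) (f : Bool → ℕ) →
  ∑[ i < n ] f (p i) ≡ f true * count p + f false * count (not ∘ p)
∑-select {zero}  p f = empty (f true) (f false)
  where
  empty : ∀ x y → 0 ≡ x * 0 + y * 0
  empty = solve-∀
∑-select {suc n} p f with p zero | ∑-select (p ∘ suc) f
... | true  | ih = trans (cong (f true +_) ih) (selected (f true) (f false) _ _)
  where
  selected : ∀ x y a b → x + (x * a + y * b) ≡ x * suc a + y * b
  selected = solve-∀
... | false | ih = trans (cong (f false +_) ih) (unselected (f true) (f false) _ _)
  where
  unselected : ∀ x y a b → y + (x * a + y * b) ≡ x * a + y * suc b
  unselected = solve-∀

count-complement : ∀ {n} (p : Fin n → Bool) → count p + count (not ∘ p) ≡ n
count-complement {zero}  p = refl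
count-complement {suc n} p with p zero | count-complement (p ∘ suc)
... | true  | ih = cong suc ih
... | false | ih = trans (+-suc _ _) (cong suc ih)

count-true : ∀ n → count {n} (λ _ → true) ≡ n
count-true zero    = refl
count-true (suc n) = cong suc (count-true n)

count-<ᵇ : ∀ {n} a → a ≤ n → count {n} (λ i → toℕ i <ᵇ a) ≡ a
count-<ᵇ {n}     zero    _         = sum-replicate-zero n
count-<ᵇ {suc n} (suc a) (s≤s a≤n) = cong suc (count-<ᵇ a a≤n)

count->ᵇ : ∀ {n} a → count {n} (λ i → a <ᵇ toℕ i) ≡ n ∸ suc a
count->ᵇ {zero}  a       = refl
count->ᵇ {suc n} zero    = count-true n
count->ᵇ {suc n} (suc a) = count->ᵇ {n} a

∣tabulate∣≡count : ∀ {n} (p : Fin n → Bool) → ∣ Vec.tabulate p ∣ ≡ count p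
∣tabulate∣≡count {zero}  p = refl
∣tabulate∣≡count {suc n} p with p zero
... | true  = cong suc (∣tabulate∣≡count (p ∘ suc))
... | false = ∣tabulate∣≡count (p ∘ suc)

∈-tabulate : ∀ {n} (p : Fin n → Bool) v → v ∈ Vec.tabulate p → T (p v)
∈-tabulate p v v∈p = subst T (sym (trans (sym (lookup∘tabulate p v)) ([]=⇒lookup v∈p))) _

filter-map : ∀ {A B : Set} {P : Pred B 0ℓ} (P? : Decidable P) (f : A → B) (xs : List A) →
  filter P? (map f xs) ≡ map f (filter (P? ∘ f) xs)
filter-map P? f []       = refl
filter-map P? f (x ∷ xs) with does (P? (f x))
... | true  = cong (f x ∷_) (filter-map P? f xs)
... | false = filter-map P? f xs

length-filter≡sum : ∀ {A : Set} {P : Pred A 0ℓ} (P? : Decidable P) (xs : List A) →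
  length (filter P? xs) ≡ sum (map (indicator ∘ does ∘ P?) xs)
length-filter≡sum P? []       = refl
length-filter≡sum P? (x ∷ xs) with does (P? x)
... | true  = cong suc (length-filter≡sum P? xs)
... | false = length-filter≡sum P? xs

sum-map-tabulate : ∀ {A : Set} {n} (f : A → ℕ) (g : Fin n → A) →
  sum (map f (tabulate g)) ≡ ∑[ i < n ] f (g i)
sum-map-tabulate {n = zero}  f g = refl
sum-map-tabulate {n = suc n} f g = cong (f (g zero) +_) (sum-map-tabulate f (g ∘ suc))

neighbours-zero : ∀ {n} → neighbours {suc n} zero ≡ tabulate suc
neighbours-zero = filter-all (λ u → ¬? (u ≟ zero)) (tabulate⁺ (λ _ ()))

neighbours-suc : ∀ {n} (w : Fin n) → neighbours {suc n} (suc w) ≡ zero ∷ map suc (neighbours w)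
neighbours-suc {n} w = cong (zero ∷_) (begin
  filter (λ u → ¬? (u ≟ suc w)) (tabulate suc)
    ≡⟨ cong (filter _) (sym (map-tabulate (λ i → i) suc)) ⟩
  filter (λ u → ¬? (u ≟ suc w)) (map suc (allFin n))
    ≡⟨ filter-map (λ u → ¬? (u ≟ suc w)) suc (allFin n) ⟩
  map suc (filter (λ u → ¬? (suc u ≟ suc w)) (allFin n))
    ≡⟨ cong (map suc) (filter-≐ _ _ ((λ ne → ne ∘ cong suc) , (λ ne → ne ∘ suc-injective)) (allFin n)) ⟩
  map suc (neighbours w) ∎)
  where open ≡-Reasoning

degree-complete : ∀ {n} (v : Fin (suc n)) → degree v ≡ n
degree-complete {n}     zero    = trans (cong length (neighbours-zero {n})) (length-tabulate (Fin.suc {n}))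
degree-complete {suc n} (suc w) =
  trans (cong length (neighbours-suc w)) (cong suc (trans (length-map Fin.suc (neighbours w)) (degree-complete w)))

neighbourSum-zero : ∀ {n} (f : Fin (suc n) → ℕ) → sum (map f (neighbours zero)) ≡ ∑[ i < n ] f (suc i)
neighbourSum-zero f = trans (cong (sum ∘ map f) neighbours-zero) (sum-map-tabulate f Fin.suc)

neighbourSum-suc : ∀ {n} (w : Fin n) (f : Fin (suc n) → ℕ) →
  sum (map f (neighbours (suc w))) ≡ f zero + sum (map (f ∘ suc) (neighbours w))
neighbourSum-suc w f =
  trans (cong (sum ∘ map f) (neighbours-suc w)) (cong (λ xs → f zero + sum xs) (sym (map-∘ (neighbours w))))

edgeSum : ∀ {n k} → EdgeColouring n k → (Fin k → ℕ) → Fin n → ℕ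
edgeSum c g v = sum (map (g ∘ c v) (neighbours v))

δ : ∀ {k} → Fin k → Fin k → ℕ
δ a b = indicator (does (a ≟ b))

colourDegree≡edgeSum : ∀ {n k} (c : EdgeColouring n k) v j → colourDegree c v j ≡ edgeSum c (λ a → δ a j) v
colourDegree≡edgeSum c v j = length-filter≡sum (λ u → c v u ≟ j) (neighbours v)

c₁ c₂ c₃ : Fin 3
c₁ = zero
c₂ = suc zero
c₃ = suc (suc zero)

toHeavy toLight : Bool → Fin 3
toHeavy marked = if marked then c₂ else c₃
toLight marked = if marked then c₂ else c₁

extend : ∀ {n} → EdgeColouring n 3 → (Fin n → Bool) → EdgeColouring (2 + n) 3
extend c p zero          (suc (suc v)) = toHeavy (p v)
extend c p (suc zero)    (suc (suc v)) = toLight (p v)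
extend c p (suc (suc u)) zero          = toHeavy (p u)
extend c p (suc (suc u)) (suc zero)    = toLight (p u)
extend c p (suc (suc u)) (suc (suc v)) = c u v
extend c p zero          zero          = c₂
extend c p zero          (suc zero)    = c₂
extend c p (suc zero)    zero          = c₂
extend c p (suc zero)    (suc zero)    = c₂

module _ {n} (c : EdgeColouring n 3) (p : Fin n → Bool) (g : Fin 3 → ℕ) where

  edgeSum-heavy : edgeSum (extend c p) g zero ≡ g c₂ + (g c₂ * count p + g c₃ * count (not ∘ p))
  edgeSum-heavy = trans (neighbourSum-zero (g ∘ extend c p zero)) (cong (g c₂ +_) (∑-select p (g ∘ toHeavy)))

  edgeSum-light : edgeSum (extend c p) g (suc zero) ≡ g c₂ + (g c₂ * count p + g c₁ * count (not ∘ p))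
  edgeSum-light = trans (neighbourSum-suc zero (g ∘ extend c p (suc zero)))
    (cong (g c₂ +_) (trans (neighbourSum-zero (g ∘ extend c p (suc zero) ∘ suc)) (∑-select p (g ∘ toLight))))

  edgeSum-old : ∀ v → edgeSum (extend c p) g (suc (suc v)) ≡ g (toHeavy (p v)) + (g (toLight (p v)) + edgeSum c g v)
  edgeSum-old v = trans (neighbourSum-suc (suc v) (g ∘ extend c p (suc (suc v))))
    (cong (g (toHeavy (p v)) +_) (neighbourSum-suc v (g ∘ extend c p (suc (suc v)) ∘ suc)))

double : ℕ → ℕ
double zero    = zero
double (suc n) = suc (suc (double n))

double≡+ : ∀ n → double n ≡ n + n
double≡+ zero    = refl
double≡+ (suc n) = cong suc (trans (cong suc (double≡+ n)) (sym (+-suc n n)))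

double≡2* : ∀ n → double n ≡ 2 * n
double≡2* n = trans (double≡+ n) (cong (n +_) (sym (+-identityʳ n)))

n≤double : ∀ n → n ≤ double n
n≤double zero    = z≤n
n≤double (suc n) = s≤s (m≤n⇒m≤1+n (n≤double n))

ceilHalf-odd : ∀ n → ceilHalf (suc (double n)) ≡ suc n
ceilHalf-odd n = begin
  ceilHalf (suc (double n)) ≡⟨ cong (ceilHalf ∘ suc) (double≡+ n) ⟩
  (suc (n + n) + 1) ℕ./ 2   ≡⟨ cong (ℕ._/ 2) (odd+1 n) ⟩
  (suc n * 2) ℕ./ 2         ≡⟨ m*n/n≡m (suc n) 2 ⟩
  suc n                     ∎
  where
  open ≡-Reasoning
  odd+1 : ∀ n → suc (n + n) + 1 ≡ suc n * 2
  odd+1 = solve-∀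

-- Since every degree in K_{2m+2} is 2m + 1, colourDegree≤ is the quasi-majority condition.
record GoodColouring (m : ℕ) (c : EdgeColouring (double (suc m)) 3) (marked : Fin (double (suc m)) → Bool) : Set where
  field
    symmetric         : IsSymmetric c
    sumDistinguishing : NeighbourSumDistinguishing c
    colourDegree≤     : ∀ v j → colourDegree c v j ≤ suc m
    σ-lower           : ∀ v → 3 * m + 1 ≤ σ c v
    σ-upper           : ∀ v → σ c v ≤ 5 * m + 3
    marked-c₂         : ∀ v → T (marked v) → colourDegree c v c₂ ≤ m

module Extension {m} {c : EdgeColouring (double (suc m)) 3} {p : Fin (double (suc m)) → Bool}
                 (good : GoodColouring m c p) (count-marked : count p ≡ m) where

  open GoodColouring good

  c′ : EdgeColouring (double (suc (suc m))) 3
  c′ = extend c p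

  count-unmarked : count (not ∘ p) ≡ 2 + m
  count-unmarked = +-cancelˡ-≡ m _ _ (begin
    m + count (not ∘ p)       ≡⟨ cong (_+ count (not ∘ p)) (sym count-marked) ⟩
    count p + count (not ∘ p) ≡⟨ count-complement p ⟩
    double (suc m)            ≡⟨ double≡+ (suc m) ⟩
    suc m + suc m             ≡⟨ sym (+-suc m (suc m)) ⟩
    m + (2 + m)               ∎)
    where open ≡-Reasoning

  counts : ∀ x y → x * count p + y * count (not ∘ p) ≡ x * m + y * (2 + m)
  counts x y = cong₂ (λ a b → x * a + y * b) count-marked count-unmarked

  σ-heavy : σ c′ zero ≡ 5 * suc m + 3
  σ-heavy = begin
    σ c′ zero                                ≡⟨ edgeSum-heavy c p colourValue ⟩
    2 + (2 * count p + 3 * count (not ∘ p))  ≡⟨ cong (2 +_) (counts 2 3) ⟩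
    2 + (2 * m + 3 * (2 + m))                ≡⟨ heavySum m ⟩
    5 * suc m + 3                            ∎
    where
    open ≡-Reasoning
    heavySum : ∀ m → 2 + (2 * m + 3 * (2 + m)) ≡ 5 * suc m + 3
    heavySum = solve-∀

  σ-light : σ c′ (suc zero) ≡ 3 * suc m + 1
  σ-light = begin
    σ c′ (suc zero)                          ≡⟨ edgeSum-light c p colourValue ⟩
    2 + (2 * count p + 1 * count (not ∘ p))  ≡⟨ cong (2 +_) (counts 2 1) ⟩
    2 + (2 * m + 1 * (2 + m))                ≡⟨ lightSum m ⟩
    3 * suc m + 1                            ∎
    where
    open ≡-Reasoning
    lightSum : ∀ m → 2 + (2 * m + 1 * (2 + m)) ≡ 3 * suc m + 1
    lightSum = solve-∀

  σ-old : ∀ v → σ c′ (suc (suc v)) ≡ 4 + σ c v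
  σ-old v = trans (edgeSum-old c p colourValue v) (newEdges (p v))
    where
    newEdges : ∀ x → colourValue (toHeavy x) + (colourValue (toLight x) + σ c v) ≡ 4 + σ c v
    newEdges true  = refl
    newEdges false = refl

  light<old : ∀ v → σ c′ (suc zero) < σ c′ (suc (suc v))
  light<old v = begin-strict
    σ c′ (suc zero)     ≡⟨ σ-light ⟩
    3 * suc m + 1       <⟨ n<1+n _ ⟩
    suc (3 * suc m + 1) ≡⟨ shift m ⟩
    4 + (3 * m + 1)     ≤⟨ +-monoʳ-≤ 4 (σ-lower v) ⟩
    4 + σ c v           ≡⟨ sym (σ-old v) ⟩
    σ c′ (suc (suc v))  ∎
    where
    open ≤-Reasoning
    shift : ∀ m → suc (3 * suc m + 1) ≡ 4 + (3 * m + 1)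
    shift = solve-∀

  old<heavy : ∀ v → σ c′ (suc (suc v)) < σ c′ zero
  old<heavy v = begin-strict
    σ c′ (suc (suc v))  ≡⟨ σ-old v ⟩
    4 + σ c v           <⟨ n<1+n _ ⟩
    5 + σ c v           ≤⟨ +-monoʳ-≤ 5 (σ-upper v) ⟩
    5 + (5 * m + 3)     ≡⟨ shift m ⟩
    5 * suc m + 3       ≡⟨ sym σ-heavy ⟩
    σ c′ zero           ∎
    where
    open ≤-Reasoning
    shift : ∀ m → 5 + (5 * m + 3) ≡ 5 * suc m + 3
    shift = solve-∀

  light<heavy : σ c′ (suc zero) < σ c′ zero
  light<heavy = <-trans (light<old zero) (old<heavy zero)

  light≤ : ∀ v → σ c′ (suc zero) ≤ σ c′ v
  light≤ zero          = <⇒≤ light<heavy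
  light≤ (suc zero)    = ≤-refl
  light≤ (suc (suc v)) = <⇒≤ (light<old v)

  ≤heavy : ∀ v → σ c′ v ≤ σ c′ zero
  ≤heavy zero          = ≤-refl
  ≤heavy (suc zero)    = <⇒≤ light<heavy
  ≤heavy (suc (suc v)) = <⇒≤ (old<heavy v)

  sumDistinguishing′ : NeighbourSumDistinguishing c′
  sumDistinguishing′ zero          zero          u≢v = contradiction refl u≢v
  sumDistinguishing′ zero          (suc zero)    _   = >⇒≢ light<heavy
  sumDistinguishing′ zero          (suc (suc v)) _   = >⇒≢ (old<heavy v)
  sumDistinguishing′ (suc zero)    zero          _   = <⇒≢ light<heavy
  sumDistinguishing′ (suc zero)    (suc zero)    u≢v = contradiction refl u≢v
  sumDistinguishing′ (suc zero)    (suc (suc v)) _   = <⇒≢ (light<old v)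
  sumDistinguishing′ (suc (suc u)) zero          _   = <⇒≢ (old<heavy u)
  sumDistinguishing′ (suc (suc u)) (suc zero)    _   = >⇒≢ (light<old u)
  sumDistinguishing′ (suc (suc u)) (suc (suc v)) u≢v σu≡σv =
    sumDistinguishing u v (u≢v ∘ cong (Fin.suc ∘ Fin.suc))
      (+-cancelˡ-≡ 4 _ _ (trans (sym (σ-old u)) (trans σu≡σv (σ-old v))))

  symmetric′ : IsSymmetric c′
  symmetric′ zero          zero          _   = refl
  symmetric′ zero          (suc zero)    _   = refl
  symmetric′ zero          (suc (suc v)) _   = refl
  symmetric′ (suc zero)    zero          _   = refl
  symmetric′ (suc zero)    (suc zero)    _   = refl
  symmetric′ (suc zero)    (suc (suc v)) _   = refl
  symmetric′ (suc (suc u)) zero          _   = refl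
  symmetric′ (suc (suc u)) (suc zero)    _   = refl
  symmetric′ (suc (suc u)) (suc (suc v)) u≢v = symmetric u v (u≢v ∘ cong (Fin.suc ∘ Fin.suc))

  colourDegree-heavy : ∀ j → colourDegree c′ zero j ≡ δ c₂ j + (δ c₂ j * m + δ c₃ j * (2 + m))
  colourDegree-heavy j = trans (colourDegree≡edgeSum c′ zero j)
    (trans (edgeSum-heavy c p (λ a → δ a j)) (cong (δ c₂ j +_) (counts (δ c₂ j) (δ c₃ j))))

  colourDegree-light : ∀ j → colourDegree c′ (suc zero) j ≡ δ c₂ j + (δ c₂ j * m + δ c₁ j * (2 + m))
  colourDegree-light j = trans (colourDegree≡edgeSum c′ (suc zero) j)
    (trans (edgeSum-light c p (λ a → δ a j)) (cong (δ c₂ j +_) (counts (δ c₂ j) (δ c₁ j))))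

  colourDegree-old : ∀ v j →
    colourDegree c′ (suc (suc v)) j ≡ δ (toHeavy (p v)) j + (δ (toLight (p v)) j + colourDegree c v j)
  colourDegree-old v j = trans (colourDegree≡edgeSum c′ (suc (suc v)) j)
    (trans (edgeSum-old c p (λ a → δ a j) v)
           (cong (λ d → δ (toHeavy (p v)) j + (δ (toLight (p v)) j + d)) (sym (colourDegree≡edgeSum c v j))))

  new-c₂ : 1 + (1 * m + 0 * (2 + m)) ≤ suc m
  new-c₂ = s≤s (≤-reflexive (simplify m))
    where
    simplify : ∀ m → 1 * m + 0 * (2 + m) ≡ m
    simplify = solve-∀

  new-unmarked : 0 + (0 * m + 1 * (2 + m)) ≤ 2 + m
  new-unmarked = ≤-reflexive (simplify m)
    where
    simplify : ∀ m → 0 + (0 * m + 1 * (2 + m)) ≡ 2 + m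
    simplify = solve-∀

  old-bound : ∀ v x → (T x → colourDegree c v c₂ ≤ m) → ∀ j →
    δ (toHeavy x) j + (δ (toLight x) j + colourDegree c v j) ≤ 2 + m
  old-bound v true  _      zero             = m≤n⇒m≤1+n (colourDegree≤ v c₁)
  old-bound v true  low-c₂ (suc zero)       = s≤s (s≤s (low-c₂ _))
  old-bound v true  _      (suc (suc zero)) = m≤n⇒m≤1+n (colourDegree≤ v c₃)
  old-bound v false _      zero             = s≤s (colourDegree≤ v c₁)
  old-bound v false _      (suc zero)       = m≤n⇒m≤1+n (colourDegree≤ v c₂)
  old-bound v false _      (suc (suc zero)) = s≤s (colourDegree≤ v c₃)

  colourDegree≤′ : ∀ v j → colourDegree c′ v j ≤ 2 + m
  colourDegree≤′ zero          j = ≤-trans (≤-reflexive (colourDegree-heavy j)) (heavy j)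
    where
    heavy : ∀ j → δ c₂ j + (δ c₂ j * m + δ c₃ j * (2 + m)) ≤ 2 + m
    heavy zero             = z≤n
    heavy (suc zero)       = m≤n⇒m≤1+n new-c₂
    heavy (suc (suc zero)) = new-unmarked
  colourDegree≤′ (suc zero)    j = ≤-trans (≤-reflexive (colourDegree-light j)) (light j)
    where
    light : ∀ j → δ c₂ j + (δ c₂ j * m + δ c₁ j * (2 + m)) ≤ 2 + m
    light zero             = new-unmarked
    light (suc zero)       = m≤n⇒m≤1+n new-c₂
    light (suc (suc zero)) = z≤n
  colourDegree≤′ (suc (suc v)) j = ≤-trans (≤-reflexive (colourDegree-old v j)) (old-bound v (p v) (marked-c₂ v) j)

  unmarked-c₂ : ∀ v x → ¬ T x → δ (toHeavy x) c₂ + (δ (toLight x) c₂ + colourDegree c v c₂) ≤ suc m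
  unmarked-c₂ v true  unmarked = contradiction _ unmarked
  unmarked-c₂ v false _        = colourDegree≤ v c₂

extend-good : ∀ {m c p} {p′ : Fin (double (suc (suc m))) → Bool} →
  GoodColouring m c p → count p ≡ m → (∀ v → T (p′ (suc (suc v))) → ¬ T (p v)) →
  GoodColouring (suc m) (extend c p) p′
extend-good {m} {c} {p} {p′} good count-marked disjoint = record
  { symmetric         = symmetric′
  ; sumDistinguishing = sumDistinguishing′
  ; colourDegree≤     = colourDegree≤′
  ; σ-lower           = λ v → subst (_≤ σ c′ v) σ-light (light≤ v)
  ; σ-upper           = λ v → subst (σ c′ v ≤_) σ-heavy (≤heavy v)
  ; marked-c₂         = marked-c₂′
  }
  where
  open Extension good count-marked

  marked-c₂′ : ∀ v → T (p′ v) → colourDegree c′ v c₂ ≤ suc m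
  marked-c₂′ zero          _      = ≤-trans (≤-reflexive (colourDegree-heavy c₂)) new-c₂
  marked-c₂′ (suc zero)    _      = ≤-trans (≤-reflexive (colourDegree-light c₂)) new-c₂
  marked-c₂′ (suc (suc v)) marked =
    ≤-trans (≤-reflexive (colourDegree-old v c₂)) (unmarked-c₂ v (p v) (disjoint v marked))

block : Bool → (m : ℕ) → Fin (double (suc m)) → Bool
block true  m i = toℕ i <ᵇ m
block false m i = suc m <ᵇ toℕ i

count-block : ∀ first m → count (block first m) ≡ m
count-block true  m = count-<ᵇ m (m≤n⇒m≤1+n (m≤n⇒m≤1+n (n≤double m)))
count-block false m = trans (count->ᵇ {double (suc m)} (suc m)) (trans (cong (_∸ m) (double≡+ m)) (m+n∸m≡n m m))

block-disjoint : ∀ first m v → T (block (not first) (suc m) (suc (suc v))) → ¬ T (block first m v)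
block-disjoint true  m v m<v v<m = <-asym (<ᵇ⇒< m (toℕ v) m<v) (<ᵇ⇒< (toℕ v) m v<m)
block-disjoint false m v 1+v<m 1+m<v =
  <-asym (<-trans (n<1+n _) (<ᵇ⇒< _ m 1+v<m)) (<-trans (n<1+n _) (<ᵇ⇒< _ (toℕ v) 1+m<v))

-- Vertex sums 8, 7, 5, 6; the diagonal is ignored.
K₄-colouring : EdgeColouring 4 3
K₄-colouring u v = Vec.lookup (Vec.lookup rows u) v
  where
  rows : Vec (Vec (Fin 3) 4) 4
  rows = (c₂ ∷ c₃ ∷ c₃ ∷ c₂ ∷ [])
       ∷ (c₃ ∷ c₂ ∷ c₁ ∷ c₃ ∷ [])
       ∷ (c₃ ∷ c₁ ∷ c₂ ∷ c₁ ∷ [])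
       ∷ (c₂ ∷ c₃ ∷ c₁ ∷ c₂ ∷ [])
       ∷ []

K₄-good : GoodColouring 1 K₄-colouring (block true 1)
K₄-good = record
  { symmetric         = from-yes (all? λ u → all? λ v → ¬? (u ≟ v) →-dec (K₄ u v ≟ K₄ v u))
  ; sumDistinguishing = from-yes (all? λ u → all? λ v → ¬? (u ≟ v) →-dec ¬? (σ K₄ u ℕ.≟ σ K₄ v))
  ; colourDegree≤     = from-yes (all? λ v → all? λ j → colourDegree K₄ v j ≤? 2)
  ; σ-lower           = from-yes (all? λ v → 3 * 1 + 1 ≤? σ K₄ v)
  ; σ-upper           = from-yes (all? λ v → σ K₄ v ≤? 5 * 1 + 3)
  ; marked-c₂         = from-yes (all? λ v → T? (block true 1 v) →-dec (colourDegree K₄ v c₂ ≤? 1))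
  }
  where
  K₄ = K₄-colouring

marksFirst : ℕ → Bool
marksFirst zero    = true
marksFirst (suc m) = not (marksFirst m)

marking : (m : ℕ) → Fin (double (suc (suc m))) → Bool
marking m = block (marksFirst m) (suc m)

colouring : (m : ℕ) → EdgeColouring (double (suc (suc m))) 3
colouring zero    = K₄-colouring
colouring (suc m) = extend (colouring m) (marking m)

colouring-good : ∀ m → GoodColouring (suc m) (colouring m) (marking m)
colouring-good zero    = K₄-good
colouring-good (suc m) =
  extend-good (colouring-good m) (count-block (marksFirst m) (suc m)) (block-disjoint (marksFirst m) (suc m))

Witness : ℕ → ℕ → Set
Witness k n =
  Σ (EdgeColouring n 3) λ c →
  IsSymmetric c × QuasiMajority c × NeighbourSumDistinguishing c ×
  Σ (Subset n) λ S → (k ∸ 1 ≤ ∣ S ∣) × ((v : Fin n) → v ∈ S → colourDegree c v c₂ ≤ k ∸ 1)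

witness : ∀ m → Witness (2 + m) (double (2 + m))
witness m =
  colouring m , symmetric , quasiMajority , sumDistinguishing ,
  Vec.tabulate (marking m) , ≤-reflexive (sym |marking|≡1+m) ,
  λ v v∈S → marked-c₂ v (∈-tabulate (marking m) v v∈S)
  where
  open GoodColouring (colouring-good m)

  quasiMajority : QuasiMajority (colouring m)
  quasiMajority v j = subst (colourDegree (colouring m) v j ≤_)
    (sym (trans (cong ceilHalf (degree-complete v)) (ceilHalf-odd (suc m)))) (colourDegree≤ v j)

  |marking|≡1+m : ∣ Vec.tabulate (marking m) ∣ ≡ suc m
  |marking|≡1+m = trans (∣tabulate∣≡count (marking m)) (count-block (marksFirst m) (suc m))

mainTheorem19 : (k : ℕ) → 2 ≤ k →
    Σ (EdgeColouring (2 * k) 3) λ c →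
    IsSymmetric c × QuasiMajority c × NeighbourSumDistinguishing c ×
    Σ (Subset (2 * k)) λ S →
    (k ∸ 1 ≤ ∣ S ∣) ×
    ((v : Fin (2 * k)) → v ∈ S → colourDegree c v (suc zero) ≤ k ∸ 1)
mainTheorem19 (suc (suc m)) (s≤s (s≤s _)) = subst (Witness (2 + m)) (double≡2* (2 + m)) (witness m)
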